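{- For positive integers $n$ and $k\ge2$ with $k\le n\le k^5-1$, if $\vec{B}\in\mathbb{F}_2^{k\times n}$ is sampled uniformly at random, then with probability at least $1-2^{ -(n-k)/2}$, \[d_{\min}(\mathcal{C}(\vec{B}))>\frac{n-k}{10\log k}.\]
   Context: $\log$ is base 2; $\mathcal{C}(\vec{B})$ is the row span of $\vec{B}$; $d_{\min}$ is the minimum Hamming weight of a nonzero codeword. -}

module Defs where

open import Data.Bool using (Bool; true; false; _xor_; if_then_else_)
import Data.Bool as Bool
open import Data.Nat using (ℕ; zero; suc; _+_; _*_; _^_; _<_; _∸_)
import Data.Nat as Nat
open import Data.List using (List; []; _∷_; [_]; concatMap; map; length; filter)
open import Data.List.Relation.Unary.Any using (Any; any?)
open import Data.Vec using (Vec; []; _∷_; replicate; zipWith)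
open import Data.Vec.Properties using (≡-dec)
open import Data.Product using (_×_)
open import Relation.Nullary using (¬_; Dec; _×-dec_; ¬?)
open import Relation.Binary.PropositionalEquality using (_≡_; _≢_)

vecsOver : {A : Set} → List A → (m : ℕ) → List (Vec A m)
vecsOver xs zero = [ [] ]
vecsOver xs (suc m) = concatMap (λ a → map (a ∷_) (vecsOver xs m)) xs

-- All vectors in F₂^m (F₂ = Bool, addition = xor).
allVecs : (m : ℕ) → List (Vec Bool m)
allVecs = vecsOver (false ∷ true ∷ [])

Matrix : ℕ → ℕ → Set
Matrix k n = Vec (Vec Bool n) k

allMatrices : (k n : ℕ) → List (Matrix k n)
allMatrices k n = vecsOver (allVecs n) k

-- The codeword x·B ∈ F₂^n (a general element of the row span C(B)).
codeword : {k n : ℕ} → Vec Bool k → Matrix k n → Vec Bool n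
codeword {n = n} [] [] = replicate n false
codeword (b ∷ x) (r ∷ B) = if b then zipWith _xor_ r (codeword x B) else codeword x B

weight : {n : ℕ} → Vec Bool n → ℕ
weight [] = 0
weight (true ∷ v) = suc (weight v)
weight (false ∷ v) = weight v

-- For k ≥ 2 and a codeword of weight w ≥ 1:
--   w > (n-k)/(10 log₂ k)  ⇔  10·w·log₂ k > n-k  ⇔  k^(10 w) > 2^(n-k).
SmallWitness : (k n : ℕ) → Matrix k n → Vec Bool k → Set
SmallWitness k n B x =
  (codeword x B ≢ replicate n false) × ¬ (2 ^ (n ∸ k) < k ^ (10 * weight (codeword x B)))

smallWitness? : (k n : ℕ) (B : Matrix k n) (x : Vec Bool k) → Dec (SmallWitness k n B x)
smallWitness? k n B x =
  ¬? (≡-dec Bool._≟_ (codeword x B) (replicate n false))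
  ×-dec ¬? (2 ^ (n ∸ k) Nat.<? k ^ (10 * weight (codeword x B)))

-- B is "bad" iff NOT (d_min(C(B)) > (n-k)/(10 log₂ k)), i.e. some nonzero
-- codeword x·B has weight ≤ (n-k)/(10 log₂ k).
Bad : (k n : ℕ) → Matrix k n → Set
Bad k n B = Any (SmallWitness k n B) (allVecs k)

bad? : (k n : ℕ) (B : Matrix k n) → Dec (Bad k n B)
bad? k n B = any? (smallWitness? k n B) (allVecs k)

badCount : (k n : ℕ) → ℕ
badCount k n = length (filter (bad? k n) (allMatrices k n))

{-# OPTIONS --safe #-}
module Submission where

-- Union bound over messages x. For x ≠ 0 the codeword x·B of a uniform B is
-- uniform on F₂ⁿ, so at most 2ᵏ·2^(kn)·L/2ⁿ matrices are bad, where L counts the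
-- nonzero words v with k^(10·wt v) ≤ 2^(n-k). If t is the largest such weight
-- (t ≤ n), these words lie in the Hamming ball of radius t, which has at most
-- (n+1)^t ≤ k^(5t) points; hence L² ≤ k^(10t) ≤ 2^(n-k), and squaring the first
-- bound gives bad² · 2^(n-k) ≤ 2^(2kn).

open import Defs
open import Data.Bool using (Bool; true; false; _xor_)
import Data.Bool as Bool
open import Data.List using (List; []; _∷_; _++_; map; concatMap; length; filter)
open import Data.List.Relation.Unary.Any using (Any; here; there)
open import Data.Nat
  using (ℕ; zero; suc; _+_; _*_; _^_; _∸_; _≤_; _<_; z≤n; s≤s; _≤?_; _<?_; >-nonZero)
open import Data.Nat.Properties
open import Algebra.Properties.CommutativeSemigroup +-commutativeSemigroup
  using () renaming (interchange to +-interchange)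
open import Algebra.Properties.CommutativeSemigroup *-commutativeSemigroup
  using (x∙yz≈y∙xz) renaming (interchange to *-interchange)
open import Data.Product using (_×_; _,_; ∃-syntax)
open import Data.Vec using (Vec; []; _∷_; replicate; zipWith)
open import Data.Vec.Properties using (≡-dec)
open import Relation.Binary.PropositionalEquality
  using (_≡_; _≢_; refl; sym; trans; cong; cong₂; subst; module ≡-Reasoning)
open import Relation.Nullary using (¬_; Dec; yes; no; ¬?; _×-dec_; contradiction)

𝟙 : ∀ {p} {P : Set p} → Dec P → ℕ
𝟙 (yes _) = 1
𝟙 (no _)  = 0

𝟙-mono : ∀ {p q} {P : Set p} {Q : Set q} → (P → Q) → (P? : Dec P) (Q? : Dec Q) → 𝟙 P? ≤ 𝟙 Q?
𝟙-mono P⇒Q (yes p) (yes _) = ≤-refl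
𝟙-mono P⇒Q (yes p) (no ¬q) = contradiction (P⇒Q p) ¬q
𝟙-mono P⇒Q (no _)  _       = z≤n

𝟙-cong : ∀ {p q} {P : Set p} {Q : Set q} → (P → Q) → (Q → P) →
         (P? : Dec P) (Q? : Dec Q) → 𝟙 P? ≡ 𝟙 Q?
𝟙-cong P⇒Q Q⇒P P? Q? = ≤-antisym (𝟙-mono P⇒Q P? Q?) (𝟙-mono Q⇒P Q? P?)

𝟙-yes : ∀ {p} {P : Set p} → P → (P? : Dec P) → 𝟙 P? ≡ 1
𝟙-yes p (yes _) = refl
𝟙-yes p (no ¬p) = contradiction p ¬p

𝟙-no : ∀ {p} {P : Set p} → ¬ P → (P? : Dec P) → 𝟙 P? ≡ 0
𝟙-no ¬p (yes p) = contradiction p ¬p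
𝟙-no ¬p (no _)  = refl

∑ : ∀ {a} {A : Set a} → List A → (A → ℕ) → ℕ
∑ []       f = 0
∑ (x ∷ xs) f = f x + ∑ xs f

infixl 10 ∑
syntax ∑ xs (λ x → e) = ∑[ x ∈ xs ] e

module _ {a} {A : Set a} where

  ∑-cong : ∀ xs {f g : A → ℕ} → (∀ x → f x ≡ g x) → ∑ xs f ≡ ∑ xs g
  ∑-cong []       f≗g = refl
  ∑-cong (x ∷ xs) f≗g = cong₂ _+_ (f≗g x) (∑-cong xs f≗g)

  ∑-mono-≤ : ∀ xs {f g : A → ℕ} → (∀ x → f x ≤ g x) → ∑ xs f ≤ ∑ xs g
  ∑-mono-≤ []       f≤g = z≤n
  ∑-mono-≤ (x ∷ xs) f≤g = +-mono-≤ (f≤g x) (∑-mono-≤ xs f≤g)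

  ∑-zero : ∀ (xs : List A) → ∑[ _ ∈ xs ] 0 ≡ 0
  ∑-zero []       = refl
  ∑-zero (x ∷ xs) = ∑-zero xs

  ∑-const : ∀ (xs : List A) c → ∑[ _ ∈ xs ] c ≡ length xs * c
  ∑-const []       c = refl
  ∑-const (x ∷ xs) c = cong (c +_) (∑-const xs c)

  ∑-++ : ∀ xs ys (f : A → ℕ) → ∑ (xs ++ ys) f ≡ ∑ xs f + ∑ ys f
  ∑-++ []       ys f = refl
  ∑-++ (x ∷ xs) ys f = trans (cong (f x +_) (∑-++ xs ys f)) (sym (+-assoc (f x) _ _))

  ∑-+ : ∀ xs (f g : A → ℕ) → ∑[ x ∈ xs ] (f x + g x) ≡ ∑ xs f + ∑ xs g
  ∑-+ []       f g = refl
  ∑-+ (x ∷ xs) f g = trans (cong (f x + g x +_) (∑-+ xs f g)) (+-interchange (f x) (g x) _ _)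

  *-distribʳ-∑ : ∀ xs (f : A → ℕ) c → ∑ xs f * c ≡ ∑[ x ∈ xs ] (f x * c)
  *-distribʳ-∑ []       f c = refl
  *-distribʳ-∑ (x ∷ xs) f c =
    trans (*-distribʳ-+ c (f x) (∑ xs f)) (cong (f x * c +_) (*-distribʳ-∑ xs f c))

module _ {a b} {A : Set a} {B : Set b} where

  ∑-map : ∀ (g : A → B) xs (f : B → ℕ) → ∑ (map g xs) f ≡ ∑[ x ∈ xs ] f (g x)
  ∑-map g []       f = refl
  ∑-map g (x ∷ xs) f = cong (f (g x) +_) (∑-map g xs f)

  ∑-concatMap : ∀ (g : A → List B) xs (f : B → ℕ) →
                ∑ (concatMap g xs) f ≡ ∑[ x ∈ xs ] ∑ (g x) f
  ∑-concatMap g []       f = refl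
  ∑-concatMap g (x ∷ xs) f =
    trans (∑-++ (g x) (concatMap g xs) f) (cong (∑ (g x) f +_) (∑-concatMap g xs f))

  ∑-swap : ∀ xs ys (h : A → B → ℕ) → ∑[ x ∈ xs ] ∑[ y ∈ ys ] h x y ≡ ∑[ y ∈ ys ] ∑[ x ∈ xs ] h x y
  ∑-swap []       ys h = sym (∑-zero ys)
  ∑-swap (x ∷ xs) ys h =
    trans (cong (∑ ys (h x) +_) (∑-swap xs ys h)) (sym (∑-+ ys (h x) (λ y → ∑[ x ∈ xs ] h x y)))

module _ {a p} {A : Set a} {P : A → Set p} (P? : ∀ x → Dec (P x)) where

  length-filter≡∑𝟙 : ∀ xs → length (filter P? xs) ≡ ∑[ x ∈ xs ] 𝟙 (P? x)
  length-filter≡∑𝟙 []       = refl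
  length-filter≡∑𝟙 (x ∷ xs) with P? x
  ... | yes _ = cong suc (length-filter≡∑𝟙 xs)
  ... | no _  = length-filter≡∑𝟙 xs

  Any⇒∑𝟙>0 : ∀ {xs} → Any P xs → 0 < ∑[ x ∈ xs ] 𝟙 (P? x)
  Any⇒∑𝟙>0 {x ∷ xs} (here px)   = ≤-trans (≤-reflexive (sym (𝟙-yes px (P? x)))) (m≤m+n _ _)
  Any⇒∑𝟙>0 {x ∷ xs} (there pxs) = ≤-trans (Any⇒∑𝟙>0 pxs) (m≤n+m _ _)

  𝟙-Any≤∑𝟙 : ∀ {xs} (Any? : Dec (Any P xs)) → 𝟙 Any? ≤ ∑[ x ∈ xs ] 𝟙 (P? x)
  𝟙-Any≤∑𝟙 (yes pxs) = Any⇒∑𝟙>0 pxs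
  𝟙-Any≤∑𝟙 (no _)    = z≤n

∑-vecsOver-suc : ∀ {A : Set} (xs : List A) m (f : Vec A (suc m) → ℕ) →
                 ∑ (vecsOver xs (suc m)) f ≡ ∑[ a ∈ xs ] ∑[ v ∈ vecsOver xs m ] f (a ∷ v)
∑-vecsOver-suc xs m f = trans (∑-concatMap (λ a → map (a ∷_) (vecsOver xs m)) xs f)
                              (∑-cong xs (λ a → ∑-map (a ∷_) (vecsOver xs m) f))

∑-vecsOver-const : ∀ {A : Set} (xs : List A) m c → ∑[ _ ∈ vecsOver xs m ] c ≡ length xs ^ m * c
∑-vecsOver-const xs zero    c = trans (+-identityʳ c) (sym (*-identityˡ c))
∑-vecsOver-const xs (suc m) c = begin
  ∑[ _ ∈ vecsOver xs (suc m) ] c                   ≡⟨ ∑-vecsOver-suc xs m (λ _ → c) ⟩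
  ∑[ _ ∈ xs ] ∑[ _ ∈ vecsOver xs m ] c             ≡⟨ ∑-cong xs (λ _ → ∑-vecsOver-const xs m c) ⟩
  ∑[ _ ∈ xs ] (length xs ^ m * c)                  ≡⟨ ∑-const xs _ ⟩
  length xs * (length xs ^ m * c)                  ≡⟨ *-assoc (length xs) _ c ⟨
  length xs ^ suc m * c                            ∎
  where open ≡-Reasoning

bools : List Bool
bools = false ∷ true ∷ []

∑-allMatrices-const : ∀ m n c → ∑[ _ ∈ allMatrices m n ] c ≡ 2 ^ (m * n) * c
∑-allMatrices-const zero    n c = trans (+-identityʳ c) (sym (*-identityˡ c))
∑-allMatrices-const (suc m) n c = begin
  ∑[ _ ∈ allMatrices (suc m) n ] c
    ≡⟨ ∑-vecsOver-suc (allVecs n) m (λ _ → c) ⟩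
  ∑[ _ ∈ allVecs n ] ∑[ _ ∈ allMatrices m n ] c
    ≡⟨ ∑-cong (allVecs n) (λ _ → ∑-allMatrices-const m n c) ⟩
  ∑[ _ ∈ allVecs n ] (2 ^ (m * n) * c)
    ≡⟨ ∑-vecsOver-const bools n _ ⟩
  2 ^ n * (2 ^ (m * n) * c)
    ≡⟨ *-assoc (2 ^ n) _ c ⟨
  2 ^ n * 2 ^ (m * n) * c
    ≡⟨ cong (_* c) (^-distribˡ-+-* 2 n (m * n)) ⟨
  2 ^ (suc m * n) * c
    ∎
  where open ≡-Reasoning

∑-Bool-xor : ∀ (h : Bool → ℕ) b → ∑[ a ∈ bools ] h (a xor b) ≡ ∑[ a ∈ bools ] h a
∑-Bool-xor h false = refl
∑-Bool-xor h true rewrite +-identityʳ (h true) | +-identityʳ (h false) = +-comm (h true) (h false)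

∑-allVecs-xor : ∀ n (g : Vec Bool n → ℕ) u →
                ∑[ r ∈ allVecs n ] g (zipWith _xor_ r u) ≡ ∑ (allVecs n) g
∑-allVecs-xor zero    g []       = refl
∑-allVecs-xor (suc n) g (b ∷ u) = begin
  ∑[ r ∈ allVecs (suc n) ] g (zipWith _xor_ r (b ∷ u))
    ≡⟨ ∑-vecsOver-suc bools n _ ⟩
  ∑[ a ∈ bools ] ∑[ r ∈ allVecs n ] g ((a xor b) ∷ zipWith _xor_ r u)
    ≡⟨ ∑-cong bools (λ a → ∑-allVecs-xor n (λ r → g ((a xor b) ∷ r)) u) ⟩
  ∑[ a ∈ bools ] ∑[ r ∈ allVecs n ] g ((a xor b) ∷ r)
    ≡⟨ ∑-Bool-xor (λ a → ∑[ r ∈ allVecs n ] g (a ∷ r)) b ⟩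
  ∑[ a ∈ bools ] ∑[ r ∈ allVecs n ] g (a ∷ r)
    ≡⟨ ∑-vecsOver-suc bools n g ⟨
  ∑ (allVecs (suc n)) g
    ∎
  where open ≡-Reasoning

module _ (n : ℕ) (g : Vec Bool n → ℕ) where

  ∑-codeword-true∷ : ∀ m (x : Vec Bool m) →
    ∑[ B ∈ allMatrices (suc m) n ] g (codeword (true ∷ x) B) ≡ 2 ^ (m * n) * ∑ (allVecs n) g
  ∑-codeword-true∷ m x = begin
    ∑[ B ∈ allMatrices (suc m) n ] g (codeword (true ∷ x) B)
      ≡⟨ ∑-vecsOver-suc (allVecs n) m _ ⟩
    ∑[ r ∈ allVecs n ] ∑[ B ∈ allMatrices m n ] g (zipWith _xor_ r (codeword x B))
      ≡⟨ ∑-swap (allVecs n) (allMatrices m n) _ ⟩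
    ∑[ B ∈ allMatrices m n ] ∑[ r ∈ allVecs n ] g (zipWith _xor_ r (codeword x B))
      ≡⟨ ∑-cong (allMatrices m n) (λ B → ∑-allVecs-xor n g (codeword x B)) ⟩
    ∑[ _ ∈ allMatrices m n ] ∑ (allVecs n) g
      ≡⟨ ∑-allMatrices-const m n _ ⟩
    2 ^ (m * n) * ∑ (allVecs n) g
      ∎
    where open ≡-Reasoning

  ∑-codeword≤ : g (replicate n false) ≡ 0 → ∀ m (x : Vec Bool m) →
    ∑[ B ∈ allMatrices m n ] g (codeword x B) * 2 ^ n ≤ 2 ^ (m * n) * ∑ (allVecs n) g
  ∑-codeword≤ g0≡0 zero [] rewrite g0≡0 = z≤n
  ∑-codeword≤ g0≡0 (suc m) (true ∷ x) = ≤-reflexive (begin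
    ∑[ B ∈ allMatrices (suc m) n ] g (codeword (true ∷ x) B) * 2 ^ n
      ≡⟨ cong (_* 2 ^ n) (∑-codeword-true∷ m x) ⟩
    2 ^ (m * n) * G * 2 ^ n
      ≡⟨ *-comm _ (2 ^ n) ⟩
    2 ^ n * (2 ^ (m * n) * G)
      ≡⟨ *-assoc (2 ^ n) _ G ⟨
    2 ^ n * 2 ^ (m * n) * G
      ≡⟨ cong (_* G) (^-distribˡ-+-* 2 n (m * n)) ⟨
    2 ^ (suc m * n) * G
      ∎)
    where
    open ≡-Reasoning
    G : ℕ
    G = ∑ (allVecs n) g
  ∑-codeword≤ g0≡0 (suc m) (false ∷ x) = begin
    ∑[ B ∈ allMatrices (suc m) n ] g (codeword (false ∷ x) B) * 2 ^ n
      ≡⟨ cong (_* 2 ^ n) (∑-vecsOver-suc (allVecs n) m _) ⟩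
    ∑[ _ ∈ allVecs n ] Y * 2 ^ n
      ≡⟨ cong (_* 2 ^ n) (∑-vecsOver-const bools n Y) ⟩
    2 ^ n * Y * 2 ^ n
      ≡⟨ *-assoc (2 ^ n) Y (2 ^ n) ⟩
    2 ^ n * (Y * 2 ^ n)
      ≤⟨ *-monoʳ-≤ (2 ^ n) (∑-codeword≤ g0≡0 m x) ⟩
    2 ^ n * (2 ^ (m * n) * G)
      ≡⟨ *-assoc (2 ^ n) _ G ⟨
    2 ^ n * 2 ^ (m * n) * G
      ≡⟨ cong (_* G) (^-distribˡ-+-* 2 n (m * n)) ⟨
    2 ^ (suc m * n) * G
      ∎
    where
    open ≤-Reasoning
    G Y : ℕ
    G = ∑ (allVecs n) g
    Y = ∑[ B ∈ allMatrices m n ] g (codeword x B)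

weight≤length : ∀ {n} (v : Vec Bool n) → weight v ≤ n
weight≤length []          = z≤n
weight≤length (true ∷ v)  = s≤s (weight≤length v)
weight≤length (false ∷ v) = m≤n⇒m≤1+n (weight≤length v)

a^[1+s]+a^s≤[1+a]^[1+s] : ∀ a s → a ^ suc s + a ^ s ≤ suc a ^ suc s
a^[1+s]+a^s≤[1+a]^[1+s] a s = begin
  a * a ^ s + a ^ s               ≤⟨ +-mono-≤ (*-monoʳ-≤ a a^s≤[1+a]^s) a^s≤[1+a]^s ⟩
  a * suc a ^ s + suc a ^ s       ≡⟨ +-comm (a * suc a ^ s) _ ⟩
  suc a ^ suc s                   ∎
  where
  open ≤-Reasoning
  a^s≤[1+a]^s : a ^ s ≤ suc a ^ s
  a^s≤[1+a]^s = ^-monoˡ-≤ s (n≤1+n a)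

hammingBall≤ : ∀ n t → ∑[ v ∈ allVecs n ] 𝟙 (weight v ≤? t) ≤ suc n ^ t
hammingBall≤ zero    t = ≤-reflexive (sym (^-zeroˡ t))
hammingBall≤ (suc n) t = begin
  ∑[ v ∈ allVecs (suc n) ] 𝟙 (weight v ≤? t)
    ≡⟨ ∑-vecsOver-suc bools n _ ⟩
  ball t + (∑[ v ∈ allVecs n ] 𝟙 (suc (weight v) ≤? t) + 0)
    ≤⟨ split t ⟩
  suc (suc n) ^ t
    ∎
  where
  open ≤-Reasoning
  ball : ℕ → ℕ
  ball s = ∑[ v ∈ allVecs n ] 𝟙 (weight v ≤? s)
  split : ∀ s → ball s + (∑[ v ∈ allVecs n ] 𝟙 (suc (weight v) ≤? s) + 0) ≤ suc (suc n) ^ s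
  split zero = begin
    ball 0 + (∑[ _ ∈ allVecs n ] 0 + 0)   ≡⟨ cong (λ z → ball 0 + (z + 0)) (∑-zero (allVecs n)) ⟩
    ball 0 + 0                           ≡⟨ +-identityʳ (ball 0) ⟩
    ball 0                               ≤⟨ hammingBall≤ n 0 ⟩
    1                                    ∎
  split (suc s) = begin
    ball (suc s) + (∑[ v ∈ allVecs n ] 𝟙 (suc (weight v) ≤? suc s) + 0)
      ≡⟨ cong (ball (suc s) +_) (trans (+-identityʳ _) (∑-cong (allVecs n) λ v →
           𝟙-cong ≤-pred s≤s (suc (weight v) ≤? suc s) (weight v ≤? s))) ⟩
    ball (suc s) + ball s
      ≤⟨ +-mono-≤ (hammingBall≤ n (suc s)) (hammingBall≤ n s) ⟩
    suc n ^ suc s + suc n ^ s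
      ≤⟨ a^[1+s]+a^s≤[1+a]^[1+s] (suc n) s ⟩
    suc (suc n) ^ suc s
      ∎

greatest≤ : ∀ {p} {P : ℕ → Set p} → (∀ w → Dec (P w)) → P 0 → ∀ u →
            ∃[ t ] P t × (∀ w → w ≤ u → P w → w ≤ t)
greatest≤ P? P0 zero = 0 , P0 , λ w w≤0 _ → w≤0
greatest≤ {P = P} P? P0 (suc u) with P? (suc u) | greatest≤ P? P0 u
... | yes P[1+u] | _ = suc u , P[1+u] , λ w w≤1+u _ → w≤1+u
... | no ¬P[1+u] | t , Pt , greatest = t , Pt , λ w w≤1+u Pw →
  greatest w (≤-pred (≤∧≢⇒< w≤1+u λ w≡1+u → ¬P[1+u] (subst P w≡1+u Pw))) Pw

LowWeight : (k n : ℕ) → Vec Bool n → Set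
LowWeight k n v = (v ≢ replicate n false) × ¬ (2 ^ (n ∸ k) < k ^ (10 * weight v))

lowWeight? : ∀ k n (v : Vec Bool n) → Dec (LowWeight k n v)
lowWeight? k n v =
  ¬? (≡-dec Bool._≟_ v (replicate n false)) ×-dec ¬? (2 ^ (n ∸ k) <? k ^ (10 * weight v))

lowWeightCount : ℕ → ℕ → ℕ
lowWeightCount k n = ∑[ v ∈ allVecs n ] 𝟙 (lowWeight? k n v)

lowWeightCount²≤ : ∀ {k n} → n < k ^ 5 → lowWeightCount k n * lowWeightCount k n ≤ 2 ^ (n ∸ k)
lowWeightCount²≤ {k} {n} n<k⁵
  with greatest≤ (λ w → k ^ (10 * w) ≤? 2 ^ (n ∸ k)) (m^n>0 2 (n ∸ k)) n
... | t , k^[10t]≤2^[n∸k] , greatest = begin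
  L * L                       ≤⟨ *-mono-≤ L≤[k⁵]^t L≤[k⁵]^t ⟩
  (k ^ 5) ^ t * (k ^ 5) ^ t   ≡⟨ ^-distribˡ-+-* (k ^ 5) t t ⟨
  (k ^ 5) ^ (t + t)           ≡⟨ ^-*-assoc k 5 (t + t) ⟩
  k ^ (5 * (t + t))           ≡⟨ cong (k ^_) 5*[t+t]≡10*t ⟩
  k ^ (10 * t)                ≤⟨ k^[10t]≤2^[n∸k] ⟩
  2 ^ (n ∸ k)                 ∎
  where
  open ≤-Reasoning
  L : ℕ
  L = lowWeightCount k n
  5*[t+t]≡10*t : 5 * (t + t) ≡ 10 * t
  5*[t+t]≡10*t = trans (*-distribˡ-+ 5 t t) (sym (*-distribʳ-+ t 5 5))
  L≤[k⁵]^t : L ≤ (k ^ 5) ^ t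
  L≤[k⁵]^t = begin
    L                                         ≤⟨ ∑-mono-≤ (allVecs n) (λ v →
      𝟙-mono (λ (_ , ¬<) → greatest (weight v) (weight≤length v) (≮⇒≥ ¬<))
             (lowWeight? k n v) (weight v ≤? t)) ⟩
    ∑[ v ∈ allVecs n ] 𝟙 (weight v ≤? t)      ≤⟨ hammingBall≤ n t ⟩
    suc n ^ t                                 ≤⟨ ^-monoˡ-≤ t n<k⁵ ⟩
    (k ^ 5) ^ t                               ∎

badCount*2^n≤ : ∀ k n → badCount k n * 2 ^ n ≤ 2 ^ k * (2 ^ (k * n) * lowWeightCount k n)
badCount*2^n≤ k n = begin
  badCount k n * 2 ^ n
    ≡⟨ cong (_* 2 ^ n) (length-filter≡∑𝟙 (bad? k n) Ms) ⟩
  ∑[ B ∈ Ms ] 𝟙 (bad? k n B) * 2 ^ n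
    ≤⟨ *-monoˡ-≤ (2 ^ n) (∑-mono-≤ Ms λ B → 𝟙-Any≤∑𝟙 (smallWitness? k n B) (bad? k n B)) ⟩
  ∑[ B ∈ Ms ] ∑[ x ∈ allVecs k ] 𝟙 (lowWeight? k n (codeword x B)) * 2 ^ n
    ≡⟨ cong (_* 2 ^ n) (∑-swap Ms (allVecs k) _) ⟩
  ∑[ x ∈ allVecs k ] ∑[ B ∈ Ms ] 𝟙 (lowWeight? k n (codeword x B)) * 2 ^ n
    ≡⟨ *-distribʳ-∑ (allVecs k) _ (2 ^ n) ⟩
  ∑[ x ∈ allVecs k ] (∑[ B ∈ Ms ] 𝟙 (lowWeight? k n (codeword x B)) * 2 ^ n)
    ≤⟨ ∑-mono-≤ (allVecs k) (∑-codeword≤ n (λ v → 𝟙 (lowWeight? k n v)) 𝟙[lowWeight[0]]≡0 k) ⟩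
  ∑[ _ ∈ allVecs k ] (2 ^ (k * n) * lowWeightCount k n)
    ≡⟨ ∑-vecsOver-const bools k _ ⟩
  2 ^ k * (2 ^ (k * n) * lowWeightCount k n)
    ∎
  where
  open ≤-Reasoning
  Ms : List (Matrix k n)
  Ms = allMatrices k n
  𝟙[lowWeight[0]]≡0 : 𝟙 (lowWeight? k n (replicate n false)) ≡ 0
  𝟙[lowWeight[0]]≡0 = 𝟙-no (λ (≢0 , _) → ≢0 refl) (lowWeight? k n (replicate n false))

badCount*2^[n∸k]≤ : ∀ {k n} → k ≤ n →
                    badCount k n * 2 ^ (n ∸ k) ≤ 2 ^ (k * n) * lowWeightCount k n
badCount*2^[n∸k]≤ {k} {n} k≤n = *-cancelˡ-≤ (2 ^ k) {{m^n≢0 2 k}} (begin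
  2 ^ k * (badCount k n * 2 ^ (n ∸ k))   ≡⟨ x∙yz≈y∙xz (2 ^ k) (badCount k n) _ ⟩
  badCount k n * (2 ^ k * 2 ^ (n ∸ k))   ≡⟨ cong (badCount k n *_) 2^k*2^[n∸k]≡2^n ⟩
  badCount k n * 2 ^ n                   ≤⟨ badCount*2^n≤ k n ⟩
  2 ^ k * (2 ^ (k * n) * lowWeightCount k n) ∎)
  where
  open ≤-Reasoning
  2^k*2^[n∸k]≡2^n : 2 ^ k * 2 ^ (n ∸ k) ≡ 2 ^ n
  2^k*2^[n∸k]≡2^n = trans (sym (^-distribˡ-+-* 2 k (n ∸ k))) (cong (2 ^_) (m+[n∸m]≡n k≤n))

mainTheorem17 : (n k : ℕ) → 2 ≤ k → k ≤ n → n ≤ k ^ 5 ∸ 1 →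
    badCount k n * badCount k n * 2 ^ (n ∸ k) ≤ 2 ^ (2 * (k * n))
mainTheorem17 n k 2≤k k≤n n≤k⁵∸1 = *-cancelʳ-≤ _ _ D {{m^n≢0 2 (n ∸ k)}} (begin
  b * b * D * D               ≡⟨ *-assoc (b * b) D D ⟩
  b * b * (D * D)             ≡⟨ *-interchange b b D D ⟩
  b * D * (b * D)             ≤⟨ *-mono-≤ bD≤QL bD≤QL ⟩
  Q * L * (Q * L)             ≡⟨ *-interchange Q L Q L ⟩
  Q * Q * (L * L)             ≤⟨ *-monoʳ-≤ (Q * Q) (lowWeightCount²≤ n<k⁵) ⟩
  Q * Q * D                   ≡⟨ cong (_* D) (^-distribˡ-+-* 2 (k * n) (k * n)) ⟨
  2 ^ (k * n + k * n) * D     ≡⟨ cong (λ e → 2 ^ (k * n + e) * D) (+-identityʳ (k * n)) ⟨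
  2 ^ (2 * (k * n)) * D       ∎)
  where
  open ≤-Reasoning
  b D Q L : ℕ
  b = badCount k n
  D = 2 ^ (n ∸ k)
  Q = 2 ^ (k * n)
  L = lowWeightCount k n
  bD≤QL : b * D ≤ Q * L
  bD≤QL = badCount*2^[n∸k]≤ k≤n
  n<k⁵ : n < k ^ 5
  n<k⁵ = m≤pred[n]⇒suc[m]≤n {{m^n≢0 k 5 {{>-nonZero (<⇒≤ 2≤k)}}}} n≤k⁵∸1
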